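{- Let $p>3$ be a prime and let $m$ be an integer with $1\le m<(p-1)/2$. Then $$\sum_{j=1}^{(p-1)/2}\frac1j\binom{2j}{j+m}\equiv\frac1m\big(1-3[3\mid p+m]\big)\pmod p.$$
   Context: $[A]$ equals $1$ if the assertion $A$ holds and $0$ otherwise. Congruences of rationals with denominators prime to $p$ are understood in the ring of rationals with denominator prime to $p$. -}

module Defs where

open import Data.Nat as ℕ using (ℕ; zero; suc)
open import Data.Nat.Divisibility using (_∣_; _∣?_)
open import Data.Integer as ℤ using (ℤ; +_)
open import Data.Rational as ℚ using (ℚ; _/_; _-_; _+_; _*_)
open import Data.Nat.Combinatorics using (_C_)
open import Data.Product using (_×_)
open import Relation.Nullary using (¬_; Dec; yes; no)

-- 1/n as a rational, for n ≥ 1 (inv 0 = 0 is a junk value, never used)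
inv : ℕ → ℚ
inv zero    = ℚ.0ℚ
inv (suc n) = (+ 1) / suc n

sumFrom1 : ℕ → (ℕ → ℚ) → ℚ
sumFrom1 zero    f = ℚ.0ℚ
sumFrom1 (suc n) f = sumFrom1 n f + f (suc n)

iv3∣ : ℕ → ℚ
iv3∣ n with 3 ∣? n
... | yes _ = ℚ.1ℚ
... | no  _ = ℚ.0ℚ

-- a ≡ b (mod p) in ℤ_(p): the reduced fraction a - b has numerator
-- divisible by p and denominator prime to p
_≡_[modℚ_] : ℚ → ℚ → ℕ → Set
a ≡ b [modℚ p ] =
  (p ∣ ℤ.∣ ℚ.numerator (a - b) ∣) × ¬ (p ∣ ℚ.denominatorℕ (a - b))

{-# OPTIONS --safe #-}
-- For j = i + 1, absorption and Pascal's rule give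
--   (m / j) C(2j, j+m) = C(2i+1, i+m) - C(2i+1, i+m+1),
-- so m times the sum is the integer F(m) = Σ_{i<n} (C(2i+1, i+m) - C(2i+1, i+m+1)), where p = 2n+1.
-- Applying Pascal's rule twice and telescoping in i gives, for m ≥ 1,
--   F(m) + F(m+1) + F(m+2) = C(p, n+m+1) - C(p, n+m+2),
-- which p divides as soon as m + 2 ≤ n. The values r(m) = 1 - 3 [3 ∣ p+m] sum to 0 over any three
-- consecutive m, and F(n) = 1 = r(n), F(n-1) = p - 2 ≡ -2 = r(n-1). Descending induction from m = n
-- gives F(m) ≡ r(m) (mod p) for 1 ≤ m ≤ n, and dividing by m, which is prime to p, gives the claim.
module Submission where

open import Defs
open import Data.Nat using (ℕ; _+_; _*_; _∸_; _/_; _<_; _≤_)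
open import Data.Nat.Primality using (Prime)
open import Data.Nat.Combinatorics using (_C_)
open import Data.Integer using (+_)
open import Data.Rational as ℚ using (ℚ)

open import Data.Nat using (zero; suc; z≤n; s≤s)
open import Data.Nat.Properties
open import Data.Nat.Combinatorics using (nCk+nC[k+1]≡[n+1]C[k+1]; k>n⇒nCk≡0; nCn≡1; nC1≡n; nCk≡nC[n∸k])
open import Data.Nat.Divisibility
  using (_∣_; _∣?_; divides; ∣⇒≤; ∣-refl; ∣-trans; ∣m+n∣m⇒∣n; ∣m∣n⇒∣m+n; ∣1⇒≡1; m∣m*n)
open import Data.Nat.DivMod using (_%_; m≡m%n+[m/n]*n; m%n<n)
open import Data.Nat.GCD using (gcd; gcd[m,n]∣n)
open import Data.Nat.Primality using (composite; euclidsLemma)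
open import Data.Nat.Tactic.RingSolver using (solve-∀)
open import Data.Integer as ℤ using (ℤ; -[1+_]; 0ℤ)
import Data.Integer.Properties as ℤP
import Data.Integer.Tactic.RingSolver as ℤSolver
import Data.Integer.Divisibility.Signed as ℤ∣
open ℤ∣ using () renaming (_∣_ to _∣ℤ_)
open import Data.Rational.Unnormalised as ℚᵘ using (mkℚᵘ; *≡*) renaming (_≃_ to _≃ᵘ_)
import Data.Rational.Unnormalised.Properties as ℚᵘP
import Data.Rational.Properties as ℚP
open import Data.Product using (_×_; _,_; proj₁; proj₂)
open import Data.Sum using (inj₁; inj₂)
open import Data.Empty using (⊥-elim)
open import Function using (case_of_)
open import Relation.Nullary using (¬_; yes; no)
open import Relation.Binary.PropositionalEquality

[k+1]*[n+1]C[k+1]≡[n+1]*nCk : ∀ n k → suc k * (suc n C suc k) ≡ suc n * (n C k)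
[k+1]*[n+1]C[k+1]≡[n+1]*nCk zero    zero    = refl
[k+1]*[n+1]C[k+1]≡[n+1]*nCk zero    (suc k) = *-zeroʳ (suc (suc k))
[k+1]*[n+1]C[k+1]≡[n+1]*nCk (suc n) zero    = trans (+-identityʳ _) (trans (nC1≡n (suc (suc n))) (sym (*-identityʳ _)))
[k+1]*[n+1]C[k+1]≡[n+1]*nCk (suc n) (suc k) = begin
  suc (suc k) * (suc (suc n) C suc (suc k))
    ≡⟨ cong (suc (suc k) *_) (nCk+nC[k+1]≡[n+1]C[k+1] (suc n) (suc k)) ⟨
  suc (suc k) * (X + Y)
    ≡⟨ expand k X Y ⟩
  X + suc k * X + suc (suc k) * Y
    ≡⟨ cong₂ (λ u v → X + u + v) ([k+1]*[n+1]C[k+1]≡[n+1]*nCk n k) ([k+1]*[n+1]C[k+1]≡[n+1]*nCk n (suc k)) ⟩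
  X + suc n * (n C k) + suc n * (n C suc k)
    ≡⟨ collect n X (n C k) (n C suc k) ⟩
  X + suc n * (n C k + n C suc k)
    ≡⟨ cong (λ u → X + suc n * u) (nCk+nC[k+1]≡[n+1]C[k+1] n k) ⟩
  suc (suc n) * X ∎
  where
  open ≡-Reasoning
  X = suc n C suc k
  Y = suc n C suc (suc k)
  expand : ∀ k X Y → suc (suc k) * (X + Y) ≡ X + suc k * X + suc (suc k) * Y
  expand = solve-∀
  collect : ∀ n X a b → X + suc n * a + suc n * b ≡ X + suc n * (a + b)
  collect = solve-∀

[n+1]Cn≡n+1 : ∀ n → suc n C n ≡ suc n
[n+1]Cn≡n+1 n = begin
  suc n C n            ≡⟨ nCk≡nC[n∸k] (n≤1+n n) ⟩
  suc n C (suc n ∸ n)  ≡⟨ cong (suc n C_) (m+n∸n≡m 1 n) ⟩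
  suc n C 1            ≡⟨ nC1≡n (suc n) ⟩
  suc n                ∎
  where open ≡-Reasoning

prime∣C : ∀ {n k} → Prime (suc n) → k < n → suc n ∣ suc n C suc k
prime∣C {n} {k} pr k<n
  with euclidsLemma (suc k) (suc n C suc k) pr
         (divides (n C k) (trans ([k+1]*[n+1]C[k+1]≡[n+1]*nCk n k) (*-comm (suc n) (n C k))))
... | inj₁ p∣1+k = ⊥-elim (<⇒≱ (s≤s k<n) (∣⇒≤ p∣1+k))
... | inj₂ p∣C   = p∣C

pos-∸ : ∀ {a b c} → a + b ≡ c → + a ≡ + c ℤ.- + b
pos-∸ {a} {b} refl = trans (cancel (+ a) (+ b)) (cong (ℤ._- + b) (sym (ℤP.pos-+ a b)))
  where
  cancel : ∀ x y → x ≡ (x ℤ.+ y) ℤ.- y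
  cancel = ℤSolver.solve-∀

ΔC : ℕ → ℕ → ℤ
ΔC n k = + (n C k) ℤ.- + (n C suc k)

ΔC-pascal : ∀ n k → ΔC (suc n) (suc k) ≡ ΔC n k ℤ.+ ΔC n (suc k)
ΔC-pascal n k = begin
  + (suc n C suc k) ℤ.- + (suc n C suc (suc k))
    ≡⟨ cong₂ ℤ._-_ (pascal k) (pascal (suc k)) ⟩
  (+ (n C k) ℤ.+ + (n C suc k)) ℤ.- (+ (n C suc k) ℤ.+ + (n C suc (suc k)))
    ≡⟨ regroup (+ (n C k)) (+ (n C suc k)) (+ (n C suc (suc k))) ⟩
  ΔC n k ℤ.+ ΔC n (suc k) ∎
  where
  open ≡-Reasoning
  pascal : ∀ k → + (suc n C suc k) ≡ + (n C k) ℤ.+ + (n C suc k)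
  pascal k = trans (cong +_ (sym (nCk+nC[k+1]≡[n+1]C[k+1] n k))) (ℤP.pos-+ (n C k) (n C suc k))
  regroup : ∀ a b c → (a ℤ.+ b) ℤ.- (b ℤ.+ c) ≡ (a ℤ.- b) ℤ.+ (b ℤ.- c)
  regroup = ℤSolver.solve-∀

ΔC-pascal² : ∀ n k → ΔC n k ℤ.+ (ΔC n (suc k) ℤ.+ ΔC n (suc k)) ℤ.+ ΔC n (suc (suc k))
                     ≡ ΔC (suc (suc n)) (suc (suc k))
ΔC-pascal² n k = begin
  a ℤ.+ (b ℤ.+ b) ℤ.+ c        ≡⟨ regroup a b c ⟩
  (a ℤ.+ b) ℤ.+ (b ℤ.+ c)      ≡⟨ cong₂ ℤ._+_ (ΔC-pascal n k) (ΔC-pascal n (suc k)) ⟨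
  ΔC (suc n) (suc k) ℤ.+ ΔC (suc n) (suc (suc k))  ≡⟨ ΔC-pascal (suc n) (suc k) ⟨
  ΔC (suc (suc n)) (suc (suc k)) ∎
  where
  open ≡-Reasoning
  a = ΔC n k
  b = ΔC n (suc k)
  c = ΔC n (suc (suc k))
  regroup : ∀ a b c → a ℤ.+ (b ℤ.+ b) ℤ.+ c ≡ (a ℤ.+ b) ℤ.+ (b ℤ.+ c)
  regroup = ℤSolver.solve-∀

ΔC-vanishes : ∀ {n k} → n < k → ΔC n k ≡ 0ℤ
ΔC-vanishes n<k = cong₂ (λ a b → + a ℤ.- + b) (k>n⇒nCk≡0 n<k) (k>n⇒nCk≡0 (m<n⇒m<1+n n<k))

ΔC-diag : ∀ n → ΔC n n ≡ + 1
ΔC-diag n = cong₂ (λ a b → + a ℤ.- + b) (nCn≡1 n) (k>n⇒nCk≡0 (n<1+n n))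

ΔC-subdiag : ∀ n → ΔC (suc n) n ≡ + n
ΔC-subdiag n = cong₂ (λ a b → + a ℤ.- + b) ([n+1]Cn≡n+1 n) (nCn≡1 (suc n))

prime∣ΔC : ∀ {n k} → Prime (suc n) → suc k < n → + suc n ∣ℤ ΔC (suc n) (suc k)
prime∣ΔC {n} {k} pr 1+k<n =
  ℤ∣.∣m∣n⇒∣m-n {m = + (suc n C suc k)} {n = + (suc n C suc (suc k))}
    (ℤ∣.∣ᵤ⇒∣ (prime∣C pr (<⇒≤ 1+k<n))) (ℤ∣.∣ᵤ⇒∣ (prime∣C pr 1+k<n))

ballot : ℕ → ℕ → ℤ
ballot i m = ΔC (suc (2 * i)) (i + m)

ballot-identityℕ : ∀ i m → (suc (suc (2 * i)) C suc (i + m)) * m + (suc (2 * i) C suc (i + m)) * suc i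
                           ≡ (suc (2 * i) C (i + m)) * suc i
ballot-identityℕ i m = +-cancelˡ-≡ (suc i * Y) _ _ (begin
  suc i * Y + (X * m + Z * suc i)  ≡⟨ regroup (suc i) m X Y Z ⟩
  suc i * (Y + Z) + X * m          ≡⟨ cong (λ u → suc i * u + X * m) (nCk+nC[k+1]≡[n+1]C[k+1] N (i + m)) ⟩
  suc i * X + X * m                ≡⟨ distrib i m X ⟩
  suc (i + m) * X                  ≡⟨ [k+1]*[n+1]C[k+1]≡[n+1]*nCk N (i + m) ⟩
  suc N * Y                        ≡⟨ double i Y ⟩
  suc i * Y + Y * suc i            ∎)
  where
  open ≡-Reasoning
  N = suc (2 * i)
  X = suc N C suc (i + m)
  Y = N C (i + m)
  Z = N C suc (i + m)
  regroup : ∀ j m X Y Z → j * Y + (X * m + Z * j) ≡ j * (Y + Z) + X * m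
  regroup = solve-∀
  distrib : ∀ i m X → suc i * X + X * m ≡ suc (i + m) * X
  distrib = solve-∀
  double : ∀ i Y → suc (suc (2 * i)) * Y ≡ suc i * Y + Y * suc i
  double = solve-∀

ballot-identity : ∀ i m → + ((2 * suc i) C (suc i + m)) ℤ.* + m ≡ ballot i m ℤ.* + suc i
ballot-identity i m = begin
  + X ℤ.* + m                                  ≡⟨ ℤP.pos-* X m ⟨
  + (X * m)                                    ≡⟨ pos-∸ (subst (λ n → (n C suc (i + m)) * m + Z * suc i ≡ Y * suc i)
                                                               (sym (*-suc 2 i)) (ballot-identityℕ i m)) ⟩
  + (Y * suc i) ℤ.- + (Z * suc i)              ≡⟨ cong₂ ℤ._-_ (ℤP.pos-* Y (suc i)) (ℤP.pos-* Z (suc i)) ⟩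
  + Y ℤ.* + suc i ℤ.- + Z ℤ.* + suc i          ≡⟨ factor (+ Y) (+ Z) (+ suc i) ⟩
  (+ Y ℤ.- + Z) ℤ.* + suc i                    ∎
  where
  open ≡-Reasoning
  X = (2 * suc i) C (suc i + m)
  Y = suc (2 * i) C (i + m)
  Z = suc (2 * i) C suc (i + m)
  factor : ∀ y z j → y ℤ.* j ℤ.- z ℤ.* j ≡ (y ℤ.- z) ℤ.* j
  factor = ℤSolver.solve-∀

ballot-pascal² : ∀ i m → ballot i m ℤ.+ (ballot i (suc m) ℤ.+ ballot i (suc m)) ℤ.+ ballot i (suc (suc m))
                         ≡ ballot (suc i) (suc m)
ballot-pascal² i m = begin
  ΔC N (i + m) ℤ.+ (ΔC N (i + suc m) ℤ.+ ΔC N (i + suc m)) ℤ.+ ΔC N (i + suc (suc m))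
    ≡⟨ cong₂ (λ k l → ΔC N (i + m) ℤ.+ (ΔC N k ℤ.+ ΔC N k) ℤ.+ ΔC N l) (+-suc i m) (shift₂ i m) ⟩
  ΔC N (i + m) ℤ.+ (ΔC N (suc (i + m)) ℤ.+ ΔC N (suc (i + m))) ℤ.+ ΔC N (suc (suc (i + m)))
    ≡⟨ ΔC-pascal² N (i + m) ⟩
  ΔC (suc (suc N)) (suc (suc (i + m)))
    ≡⟨ cong₂ ΔC (cong suc (sym (*-suc 2 i))) (cong suc (sym (+-suc i m))) ⟩
  ballot (suc i) (suc m) ∎
  where
  open ≡-Reasoning
  N = suc (2 * i)
  shift₂ : ∀ i m → i + suc (suc m) ≡ suc (suc (i + m))
  shift₂ = solve-∀

ballot-vanishes : ∀ {i m} → suc (suc i) ≤ m → ballot i m ≡ 0ℤ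
ballot-vanishes {i} {m} 2+i≤m = ΔC-vanishes (begin
  suc (suc (2 * i))      ≡⟨ shape i ⟩
  i + suc (suc i)        ≤⟨ +-monoʳ-≤ i 2+i≤m ⟩
  i + m                  ∎)
  where
  open ≤-Reasoning
  shape : ∀ i → suc (suc (2 * i)) ≡ i + suc (suc i)
  shape = solve-∀

ballot-diag : ∀ i → ballot i (suc i) ≡ + 1
ballot-diag i = trans (cong (ΔC (suc (2 * i))) (shape i)) (ΔC-diag (suc (2 * i)))
  where
  shape : ∀ i → i + suc i ≡ suc (2 * i)
  shape = solve-∀

ballot-subdiag : ∀ n → ballot n n ≡ + (2 * n)
ballot-subdiag n = trans (cong (ΔC (suc (2 * n))) (shape n)) (ΔC-subdiag (2 * n))
  where
  shape : ∀ n → n + n ≡ 2 * n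
  shape = solve-∀

prime∣ballot : ∀ {n m} → Prime (suc (2 * n)) → suc (suc m) ≤ n → + suc (2 * n) ∣ℤ ballot n (suc m)
prime∣ballot {n} {m} pr 2+m≤n = subst (λ k → + suc (2 * n) ∣ℤ ΔC (suc (2 * n)) k) (sym (+-suc n m))
  (prime∣ΔC pr (begin
    suc (suc (n + m))   ≡⟨ cong suc (+-suc n m) ⟨
    suc (n + suc m)     ≡⟨ +-suc n (suc m) ⟨
    n + suc (suc m)     ≤⟨ +-monoʳ-≤ n 2+m≤n ⟩
    n + n               ≡⟨ shape n ⟩
    2 * n               ∎))
  where
  open ≤-Reasoning
  shape : ∀ n → n + n ≡ 2 * n
  shape = solve-∀

ballotSum : ℕ → ℕ → ℤ
ballotSum zero    m = 0ℤ
ballotSum (suc n) m = ballotSum n m ℤ.+ ballot n m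

ballotSum-vanishes : ∀ {n m} → n < m → ballotSum n m ≡ 0ℤ
ballotSum-vanishes {zero}  n<m = refl
ballotSum-vanishes {suc n} {m} n<m = cong₂ ℤ._+_ (ballotSum-vanishes {n} {m} (<⇒≤ n<m)) (ballot-vanishes n<m)

ballotSum-diag : ∀ n → ballotSum (suc n) (suc n) ≡ + 1
ballotSum-diag n = cong₂ ℤ._+_ (ballotSum-vanishes (n<1+n n)) (ballot-diag n)

ballotSum-three-terms : ∀ n m → ballotSum n m ℤ.+ ballotSum n (suc m) ℤ.+ ballotSum n (suc (suc m))
                          ≡ ballot n (suc m) ℤ.- ballot 0 (suc m)
ballotSum-three-terms zero    m = sym (ℤP.+-inverseʳ (ballot 0 (suc m)))
ballotSum-three-terms (suc n) m = begin
  (s₀ ℤ.+ b₀) ℤ.+ (s₁ ℤ.+ b₁) ℤ.+ (s₂ ℤ.+ b₂)            ≡⟨ regroup s₀ s₁ s₂ b₀ b₁ b₂ ⟩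
  (s₀ ℤ.+ s₁ ℤ.+ s₂) ℤ.+ (b₀ ℤ.+ (b₁ ℤ.+ b₁) ℤ.+ b₂) ℤ.- b₁ ≡⟨ cong₂ (λ u v → u ℤ.+ v ℤ.- b₁) (ballotSum-three-terms n m) (ballot-pascal² n m) ⟩
  (b₁ ℤ.- c) ℤ.+ ballot (suc n) (suc m) ℤ.- b₁            ≡⟨ cancel b₁ c (ballot (suc n) (suc m)) ⟩
  ballot (suc n) (suc m) ℤ.- c                            ∎
  where
  open ≡-Reasoning
  s₀ = ballotSum n m
  s₁ = ballotSum n (suc m)
  s₂ = ballotSum n (suc (suc m))
  b₀ = ballot n m
  b₁ = ballot n (suc m)
  b₂ = ballot n (suc (suc m))
  c  = ballot 0 (suc m)
  regroup : ∀ s₀ s₁ s₂ b₀ b₁ b₂ → (s₀ ℤ.+ b₀) ℤ.+ (s₁ ℤ.+ b₁) ℤ.+ (s₂ ℤ.+ b₂)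
                                  ≡ (s₀ ℤ.+ s₁ ℤ.+ s₂) ℤ.+ (b₀ ℤ.+ (b₁ ℤ.+ b₁) ℤ.+ b₂) ℤ.- b₁
  regroup = ℤSolver.solve-∀
  cancel : ∀ b c a → (b ℤ.- c) ℤ.+ a ℤ.- b ≡ a ℤ.- c
  cancel = ℤSolver.solve-∀

prime∣ballotSum-three-terms : ∀ {n k} → Prime (suc (2 * n)) → suc (suc (suc k)) ≤ n →
  + suc (2 * n) ∣ℤ ballotSum n (suc k) ℤ.+ ballotSum n (suc (suc k)) ℤ.+ ballotSum n (suc (suc (suc k)))
prime∣ballotSum-three-terms {n} {k} pr 3+k≤n = subst (+ suc (2 * n) ∣ℤ_) (sym (begin
  ballotSum n (suc k) ℤ.+ ballotSum n (suc (suc k)) ℤ.+ ballotSum n (suc (suc (suc k)))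
    ≡⟨ ballotSum-three-terms n (suc k) ⟩
  ballot n (suc (suc k)) ℤ.- ballot 0 (suc (suc k))
    ≡⟨ cong (λ b → ballot n (suc (suc k)) ℤ.- b) (ballot-vanishes {0} {suc (suc k)} (s≤s (s≤s z≤n))) ⟩
  ballot n (suc (suc k)) ℤ.- 0ℤ
    ≡⟨ ℤP.+-identityʳ (ballot n (suc (suc k))) ⟩
  ballot n (suc (suc k)) ∎)) (prime∣ballot pr 3+k≤n)
  where open ≡-Reasoning

-- r₃ x = 1 - 3 [3 ∣ x], defined by recursion so that its 3-periodicity is definitional.
r₃ : ℕ → ℤ
r₃ 0 = -[1+ 1 ]
r₃ 1 = + 1
r₃ 2 = + 1
r₃ (suc (suc (suc x))) = r₃ x

r₃-sum : ∀ x → r₃ x ℤ.+ r₃ (suc x) ℤ.+ r₃ (suc (suc x)) ≡ 0ℤ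
r₃-sum 0 = refl
r₃-sum 1 = refl
r₃-sum 2 = refl
r₃-sum (suc (suc (suc x))) = r₃-sum x

r₃-sum-shifted : ∀ x m → r₃ (x + m) ℤ.+ r₃ (x + suc m) ℤ.+ r₃ (x + suc (suc m)) ≡ 0ℤ
r₃-sum-shifted x m rewrite +-suc x (suc m) | +-suc x m = r₃-sum (x + m)

r₃-∣ : ∀ {x} → 3 ∣ x → r₃ x ≡ -[1+ 1 ]
r₃-∣ {0} _ = refl
r₃-∣ {1} 3∣1 = ⊥-elim (<⇒≱ (s≤s (s≤s z≤n)) (∣⇒≤ 3∣1))
r₃-∣ {2} 3∣2 = ⊥-elim (<⇒≱ (s≤s (s≤s (s≤s z≤n))) (∣⇒≤ 3∣2))
r₃-∣ {suc (suc (suc x))} 3∣3+x = r₃-∣ (∣m+n∣m⇒∣n 3∣3+x (∣-refl {3}))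

r₃-∤ : ∀ {x} → ¬ 3 ∣ x → r₃ x ≡ + 1
r₃-∤ {0} 3∤0 = ⊥-elim (3∤0 (divides 0 refl))
r₃-∤ {1} _ = refl
r₃-∤ {2} _ = refl
r₃-∤ {suc (suc (suc x))} 3∤3+x = r₃-∤ (λ 3∣x → 3∤3+x (∣m∣n⇒∣m+n (∣-refl {3}) 3∣x))

r₃-3* : ∀ k → r₃ (3 * k) ≡ -[1+ 1 ]
r₃-3* k = r₃-∣ (m∣m*n k)

r₃-1+3* : ∀ k → r₃ (suc (3 * k)) ≡ + 1
r₃-1+3* k = r₃-∤ λ 3∣1+3k → case ∣1⇒≡1 (∣m+n∣m⇒∣n (subst (3 ∣_) (+-comm 1 (3 * k)) 3∣1+3k) (m∣m*n k)) of λ ()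

downward-induction : ∀ {ℓ} (Q : ℕ → Set ℓ) n → Q n → Q (suc n) →
                     (∀ m → m < n → Q (suc m) → Q (suc (suc m)) → Q m) → ∀ m → m ≤ n → Q m
downward-induction Q n Qn Q1+n step m m≤n = proj₁ (pair (n ∸ m) m (m+[n∸m]≡n m≤n))
  where
  pair : ∀ d m → m + d ≡ n → Q m × Q (suc m)
  pair zero    m refl rewrite +-identityʳ m = Qn , Q1+n
  pair (suc d) m m+1+d≡n =
    step m (subst (m <_) m+1+d≡n (m<m+n m (s≤s z≤n))) (proj₁ next) (proj₂ next) , proj₁ next
    where
    next = pair d (suc m) (trans (sym (+-suc m d)) m+1+d≡n)

∣-three-term-step : ∀ {d} (x r : ℕ → ℤ) m →
                    d ∣ℤ x m ℤ.+ x (suc m) ℤ.+ x (suc (suc m)) → r m ℤ.+ r (suc m) ℤ.+ r (suc (suc m)) ≡ 0ℤ →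
                    d ∣ℤ x (suc m) ℤ.- r (suc m) → d ∣ℤ x (suc (suc m)) ℤ.- r (suc (suc m)) → d ∣ℤ x m ℤ.- r m
∣-three-term-step {d} x r m d∣x r≡0 d∣y₁ d∣y₂ =
  subst (d ∣ℤ_) (sym x₀-r₀≡rest) (ℤ∣.∣m∣n⇒∣m-n (ℤ∣.∣m∣n⇒∣m-n d∣x d∣y₁) d∣y₂)
  where
  open ≡-Reasoning
  x₀ = x m
  x₁ = x (suc m)
  x₂ = x (suc (suc m))
  r₀ = r m
  r₁ = r (suc m)
  r₂ = r (suc (suc m))
  rest = x₀ ℤ.+ x₁ ℤ.+ x₂ ℤ.- (x₁ ℤ.- r₁) ℤ.- (x₂ ℤ.- r₂)
  split : ∀ x₀ x₁ x₂ r₀ r₁ r₂ →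
          x₀ ℤ.- r₀ ≡ x₀ ℤ.+ x₁ ℤ.+ x₂ ℤ.- (x₁ ℤ.- r₁) ℤ.- (x₂ ℤ.- r₂) ℤ.- (r₀ ℤ.+ r₁ ℤ.+ r₂)
  split = ℤSolver.solve-∀
  x₀-r₀≡rest : x₀ ℤ.- r₀ ≡ rest
  x₀-r₀≡rest = begin
    x₀ ℤ.- r₀                          ≡⟨ split x₀ x₁ x₂ r₀ r₁ r₂ ⟩
    rest ℤ.- (r₀ ℤ.+ r₁ ℤ.+ r₂)        ≡⟨ cong (λ s → rest ℤ.- s) r≡0 ⟩
    rest ℤ.- 0ℤ                        ≡⟨ ℤP.+-identityʳ rest ⟩
    rest                               ∎

ballotSum-congruence : ∀ {n m} → Prime (suc (2 * n)) → 1 ≤ m → m < n →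
                       + suc (2 * n) ∣ℤ ballotSum n m ℤ.- r₃ (suc (2 * n) + m)
ballotSum-congruence {suc (suc n₂)} {suc k} pr _ (s≤s (s≤s k≤n₂)) =
  downward-induction Q n₂ at-n-1 at-n step k k≤n₂
  where
  open ≡-Reasoning
  n = suc (suc n₂)
  p = suc (2 * n)
  Q : ℕ → Set
  Q k = + p ∣ℤ ballotSum n (suc k) ℤ.- r₃ (p + suc k)

  at-n : Q (suc n₂)
  at-n = subst (+ p ∣ℤ_) (sym (begin
    ballotSum n n ℤ.- r₃ (p + n)       ≡⟨ cong₂ ℤ._-_ (ballotSum-diag (suc n₂)) (cong r₃ (shape n)) ⟩
    + 1 ℤ.- r₃ (suc (3 * n))           ≡⟨ cong (λ r → + 1 ℤ.- r) (r₃-1+3* n) ⟩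
    0ℤ                                 ∎)) (ℤ∣.divides 0ℤ (sym (ℤP.*-zeroˡ (+ p))))
    where
    shape : ∀ n → suc (2 * n) + n ≡ suc (3 * n)
    shape = solve-∀

  at-n-1 : Q n₂
  at-n-1 = subst (+ p ∣ℤ_) (sym (begin
    F₀ ℤ.- r₃ (p + suc n₂)                   ≡⟨ isolate F₀ F₁ F₂ (r₃ (p + suc n₂)) ⟩
    (F₀ ℤ.+ F₁ ℤ.+ F₂) ℤ.- F₁ ℤ.- F₂ ℤ.- r₃ (p + suc n₂)
      ≡⟨ cong₂ (λ s r → s ℤ.- F₁ ℤ.- F₂ ℤ.- r) (ballotSum-three-terms n (suc n₂)) (cong r₃ (shape n₂)) ⟩
    (ballot n n ℤ.- ballot 0 n) ℤ.- F₁ ℤ.- F₂ ℤ.- r₃ (3 * n)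
      ≡⟨ cong₂ (λ b f → (b ℤ.- ballot 0 n) ℤ.- f ℤ.- F₂ ℤ.- r₃ (3 * n)) (ballot-subdiag n) (ballotSum-diag (suc n₂)) ⟩
    (+ (2 * n) ℤ.- ballot 0 n) ℤ.- + 1 ℤ.- F₂ ℤ.- r₃ (3 * n)
      ≡⟨ cong₂ (λ b f → (+ (2 * n) ℤ.- b) ℤ.- + 1 ℤ.- f ℤ.- r₃ (3 * n))
               (ballot-vanishes {0} {n} (s≤s (s≤s z≤n))) (ballotSum-vanishes (n<1+n n)) ⟩
    (+ (2 * n) ℤ.- 0ℤ) ℤ.- + 1 ℤ.- 0ℤ ℤ.- r₃ (3 * n)
      ≡⟨ cong (λ r → (+ (2 * n) ℤ.- 0ℤ) ℤ.- + 1 ℤ.- 0ℤ ℤ.- r) (r₃-3* n) ⟩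
    (+ (2 * n) ℤ.- 0ℤ) ℤ.- + 1 ℤ.- 0ℤ ℤ.- -[1+ 1 ]
      ≡⟨ simplify (+ (2 * n)) ⟩
    + p ∎)) (ℤ∣.∣-refl {+ p})
    where
    F₀ = ballotSum n (suc n₂)
    F₁ = ballotSum n n
    F₂ = ballotSum n (suc n)
    isolate : ∀ a b c r → a ℤ.- r ≡ (a ℤ.+ b ℤ.+ c) ℤ.- b ℤ.- c ℤ.- r
    isolate = ℤSolver.solve-∀
    shape : ∀ n₂ → suc (2 * suc (suc n₂)) + suc n₂ ≡ 3 * suc (suc n₂)
    shape = solve-∀
    simplify : ∀ x → (x ℤ.- 0ℤ) ℤ.- + 1 ℤ.- 0ℤ ℤ.- -[1+ 1 ] ≡ + 1 ℤ.+ x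
    simplify = ℤSolver.solve-∀

  step : ∀ k → k < n₂ → Q (suc k) → Q (suc (suc k)) → Q k
  step k k<n₂ = ∣-three-term-step (ballotSum n) (λ m → r₃ (p + m)) (suc k)
    (prime∣ballotSum-three-terms pr (s≤s (s≤s k<n₂))) (r₃-sum-shifted p (suc k))

mkℚᵘ-+ : ∀ a b d → mkℚᵘ a d ℚᵘ.+ mkℚᵘ b d ≃ᵘ mkℚᵘ (a ℤ.+ b) d
mkℚᵘ-+ a b d = *≡* (trans (factor a b (+ suc d)) (cong ((a ℤ.+ b) ℤ.*_) (sym (ℤP.pos-* (suc d) (suc d)))))
  where
  factor : ∀ a b s → (a ℤ.* s ℤ.+ b ℤ.* s) ℤ.* s ≡ (a ℤ.+ b) ℤ.* (s ℤ.* s)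
  factor = ℤSolver.solve-∀

toℚᵘ-inv*[z/1] : ∀ d z → ℚ.toℚᵘ (inv (suc d) ℚ.* (z ℚ./ 1)) ≃ᵘ mkℚᵘ z d
toℚᵘ-inv*[z/1] d z = begin
  ℚ.toℚᵘ (inv (suc d) ℚ.* (z ℚ./ 1))               ≈⟨ ℚP.toℚᵘ-homo-* (inv (suc d)) (z ℚ./ 1) ⟩
  ℚ.toℚᵘ (inv (suc d)) ℚᵘ.* ℚ.toℚᵘ (z ℚ./ 1)      ≈⟨ ℚᵘP.*-cong (ℚP.toℚᵘ-fromℚᵘ (mkℚᵘ (+ 1) d))
                                                                  (ℚP.toℚᵘ-fromℚᵘ (mkℚᵘ z 0)) ⟩
  mkℚᵘ (+ 1) d ℚᵘ.* mkℚᵘ z 0                       ≈⟨ *≡* (cong₂ ℤ._*_ (ℤP.*-identityˡ z) (cong +_ (sym (*-identityʳ (suc d))))) ⟩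
  mkℚᵘ z d                                         ∎
  where open ℚᵘP.≃-Reasoning

toℚᵘ-series : ∀ n m → ℚ.toℚᵘ (sumFrom1 n (λ j → inv j ℚ.* (+ ((2 * j) C (j + suc m)) ℚ./ 1)))
                      ≃ᵘ mkℚᵘ (ballotSum n (suc m)) m
toℚᵘ-series zero    m = *≡* refl
toℚᵘ-series (suc n) m = begin
  ℚ.toℚᵘ (sumFrom1 n term ℚ.+ term (suc n))                ≈⟨ ℚP.toℚᵘ-homo-+ (sumFrom1 n term) (term (suc n)) ⟩
  ℚ.toℚᵘ (sumFrom1 n term) ℚᵘ.+ ℚ.toℚᵘ (term (suc n))      ≈⟨ ℚᵘP.+-cong (toℚᵘ-series n m) term≃ ⟩
  mkℚᵘ (ballotSum n (suc m)) m ℚᵘ.+ mkℚᵘ (ballot n (suc m)) m ≈⟨ mkℚᵘ-+ (ballotSum n (suc m)) (ballot n (suc m)) m ⟩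
  mkℚᵘ (ballotSum (suc n) (suc m)) m                       ∎
  where
  open ℚᵘP.≃-Reasoning
  term : ℕ → ℚ
  term j = inv j ℚ.* (+ ((2 * j) C (j + suc m)) ℚ./ 1)
  term≃ : ℚ.toℚᵘ (term (suc n)) ≃ᵘ mkℚᵘ (ballot n (suc m)) m
  term≃ = ℚᵘP.≃-trans (toℚᵘ-inv*[z/1] n (+ ((2 * suc n) C (suc n + suc m)))) (*≡* (ballot-identity n (suc m)))

toℚᵘ-r₃ : ∀ x m → ℚ.toℚᵘ (inv (suc m) ℚ.* (ℚ.1ℚ ℚ.- (+ 3 ℚ./ 1) ℚ.* iv3∣ x)) ≃ᵘ mkℚᵘ (r₃ x) m
toℚᵘ-r₃ x m with 3 ∣? x
... | yes 3∣x rewrite r₃-∣ 3∣x = toℚᵘ-inv*[z/1] m -[1+ 1 ]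
... | no  3∤x rewrite r₃-∤ 3∤x = toℚᵘ-inv*[z/1] m (+ 1)

toℚᵘ-difference : ∀ {p q a b d} → ℚ.toℚᵘ p ≃ᵘ mkℚᵘ a d → ℚ.toℚᵘ q ≃ᵘ mkℚᵘ b d →
                  ℚ.toℚᵘ (p ℚ.- q) ≃ᵘ mkℚᵘ (a ℤ.- b) d
toℚᵘ-difference {p} {q} {a} {b} {d} p≃ q≃ = begin
  ℚ.toℚᵘ (p ℚ.- q)                  ≈⟨ ℚP.toℚᵘ-homo-+ p (ℚ.- q) ⟩
  ℚ.toℚᵘ p ℚᵘ.+ ℚ.toℚᵘ (ℚ.- q)     ≈⟨ ℚᵘP.+-cong p≃ (ℚᵘP.≃-trans (ℚP.toℚᵘ-homo‿- q) (ℚᵘP.-‿cong q≃)) ⟩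
  mkℚᵘ a d ℚᵘ.+ mkℚᵘ (ℤ.- b) d      ≈⟨ mkℚᵘ-+ a (ℤ.- b) d ⟩
  mkℚᵘ (a ℤ.- b) d                  ∎
  where open ℚᵘP.≃-Reasoning

/-prime∣↥∧∤↧ : ∀ {p d} z → Prime p → ¬ p ∣ suc d → p ∣ ℤ.∣ z ∣ →
              (p ∣ ℤ.∣ ℚ.↥ (z ℚ./ suc d) ∣) × ¬ (p ∣ ℚ.↧ₙ (z ℚ./ suc d))
/-prime∣↥∧∤↧ {p} {d} z pr p∤1+d p∣z = p∣num , p∤den
  where
  q = z ℚ./ suc d
  g = gcd ℤ.∣ z ∣ (suc d)
  num*g : ℤ.∣ ℚ.↥ q ∣ * g ≡ ℤ.∣ z ∣
  num*g = trans (sym (ℤP.abs-* (ℚ.↥ q) (+ g))) (cong ℤ.∣_∣ (ℚP.↥-/ z (suc d)))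
  den*g : ℚ.↧ₙ q * g ≡ suc d
  den*g = trans (sym (ℤP.abs-* (ℚ.↧ q) (+ g))) (cong ℤ.∣_∣ (ℚP.↧-/ z (suc d)))
  p∤g : ¬ p ∣ g
  p∤g p∣g = p∤1+d (∣-trans p∣g (gcd[m,n]∣n ℤ.∣ z ∣ (suc d)))
  p∣num : p ∣ ℤ.∣ ℚ.↥ q ∣
  p∣num with euclidsLemma ℤ.∣ ℚ.↥ q ∣ g pr (subst (p ∣_) (sym num*g) p∣z)
  ... | inj₁ p∣num′ = p∣num′
  ... | inj₂ p∣g    = ⊥-elim (p∤g p∣g)
  p∤den : ¬ p ∣ ℚ.↧ₙ q
  p∤den p∣den = p∤1+d (∣-trans p∣den (subst (ℚ.↧ₙ q ∣_) den*g (m∣m*n g)))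

≡[modℚ]-intro : ∀ {a b p d x y} → Prime p → ¬ p ∣ suc d → + p ∣ℤ x ℤ.- y →
                ℚ.toℚᵘ a ≃ᵘ mkℚᵘ x d → ℚ.toℚᵘ b ≃ᵘ mkℚᵘ y d → a ≡ b [modℚ p ]
≡[modℚ]-intro {a} {b} {p} {d} {x} {y} pr p∤1+d p∣x-y a≃ b≃ =
  subst (λ q → (p ∣ ℤ.∣ ℚ.↥ q ∣) × ¬ (p ∣ ℚ.↧ₙ q)) (sym a-b≡[x-y]/[1+d])
    (/-prime∣↥∧∤↧ (x ℤ.- y) pr p∤1+d (ℤ∣.∣⇒∣ᵤ p∣x-y))
  where
  a-b≡[x-y]/[1+d] : a ℚ.- b ≡ (x ℤ.- y) ℚ./ suc d
  a-b≡[x-y]/[1+d] = ℚP.toℚᵘ-injective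
    (ℚᵘP.≃-trans (toℚᵘ-difference a≃ b≃) (ℚᵘP.≃-sym (ℚP.toℚᵘ-fromℚᵘ (mkℚᵘ (x ℤ.- y) d))))

prime>2⇒p≡1+2*[p∸1]/2 : ∀ {p} → Prime p → 2 < p → p ≡ suc (2 * ((p ∸ 1) / 2))
prime>2⇒p≡1+2*[p∸1]/2 {suc q} pr 2<p with q % 2 | m≡m%n+[m/n]*n q 2 | m%n<n q 2
... | 0           | q≡ | _ = cong suc (trans q≡ (*-comm (q / 2) 2))
... | 1           | q≡ | _ =
  ⊥-elim (Prime.notComposite pr (composite 2<p (divides (suc (q / 2)) (trans (cong suc q≡) (shape (q / 2))))))
  where
  shape : ∀ h → suc (1 + h * 2) ≡ suc h * 2
  shape = solve-∀
... | suc (suc _) | _  | s≤s (s≤s ())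

lemma2p2 : (p m : ℕ) → Prime p → 3 < p → 1 ≤ m → m < (p ∸ 1) / 2 →
    sumFrom1 ((p ∸ 1) / 2) (λ j → inv j ℚ.* (+ ((2 * j) C (j + m)) ℚ./ 1))
      ≡ inv m ℚ.* (ℚ.1ℚ ℚ.- (+ 3 ℚ./ 1) ℚ.* iv3∣ (p + m)) [modℚ p ]
lemma2p2 p (suc m) pr 3<p 1≤m m<n =
  ≡[modℚ]-intro pr p∤1+m p∣difference (toℚᵘ-series n m) (toℚᵘ-r₃ (p + suc m) m)
  where
  n = (p ∸ 1) / 2
  p≡1+2n : p ≡ suc (2 * n)
  p≡1+2n = prime>2⇒p≡1+2*[p∸1]/2 pr (<⇒≤ 3<p)
  p∣difference : + p ∣ℤ ballotSum n (suc m) ℤ.- r₃ (p + suc m)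
  p∣difference = subst (λ q → + q ∣ℤ ballotSum n (suc m) ℤ.- r₃ (q + suc m)) (sym p≡1+2n)
    (ballotSum-congruence (subst Prime p≡1+2n pr) 1≤m m<n)
  p∤1+m : ¬ p ∣ suc m
  p∤1+m p∣1+m = <⇒≱ (<-≤-trans m<n (subst (n ≤_) (sym p≡1+2n) (≤-trans (m≤m+n n (n + 0)) (n≤1+n _))))
                    (∣⇒≤ p∣1+m)
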